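{- Suppose $T=(T,S,\epsilon F)$ and $T'=(T,S,\epsilon' F)$ are two BY forests differing only in their sign functions, such that for every $F$-orbit $C,FC,\dots,F^{q-1}C$ of components of $T\setminus S$ we have $\prod_{i=0}^{q-1}\epsilon(F^iC)=\prod_{i=0}^{q-1}\epsilon'(F^iC)$. Then $T$ and $T'$ are signed isomorphic. In particular, every BY forest is signed isomorphic to a BY forest whose sign function takes the value $-1$ at most once on each $F$-orbit of components of $T\setminus S$.
   Context: A BY forest is a triple $T=(T,S,\epsilon F)$ where $T$ is a finite graph-theoretic forest with an edge-length function $l:E(T)\to\{1,2,3,\dots\}$, $S\subseteq T$ is a subgraph, $F$ is a length-preserving automorphism of $T$ with $F(S)=S$, and $\epsilon:\pi_0(T\setminus S)\to\{\pm1\}$ is a function on the components of the topological complement $T\setminus S$; the pair $\epsilon F=(F,\epsilon)$ is a signed automorphism of $(T,S)$. A signed isomorphism $\epsilon F:(T,S)\to(T',S')$ between such pairs is an isometric isomorphism of pairs $F$ together with a sign function $\epsilon$ on $\pi_0(T\setminus S)$; the composite of $\epsilon F:(T,S)\to(T',S')$ and $\epsilon'F':(T',S')\to(T'',S'')$ has underlying map $F'F$ and sign $C\mapsto\epsilon(C)\epsilon'(FC)$. A signed isomorphism between BY forests $(T,S,\epsilon F)\to(T',S',\epsilon'F')$ is a signed isomorphism $\epsilon''F'':(T,S)\to(T',S')$ with $(\epsilon''F'')\circ(\epsilon F)=(\epsilon'F')\circ(\epsilon''F'')$. -}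

module Defs where

open import Data.Nat using (ℕ; zero; suc; _≤_; _<_)
open import Data.Fin using (Fin)
open import Data.Bool using (Bool; true; false)
open import Data.Sum using (_⊎_; inj₁; inj₂)
open import Data.Product using (Σ; _×_; _,_; proj₁)
open import Data.Empty using (⊥)
open import Data.List using (List; []; _∷_)
open import Data.List.Relation.Unary.Unique.Propositional using (Unique)
open import Data.Sign using (Sign) renaming (_*_ to _·_)
import Data.Sign as Sg
open import Relation.Nullary using (¬_)
open import Relation.Binary.PropositionalEquality using (_≡_; trans)
open import Relation.Binary.Construct.Closure.Equivalence using (EqClosure)

-- Finite multigraphs: vertices Fin nV, edges Fin nE, each edge e joins
-- src e and tgt e (undirected; the orientation is only bookkeeping).

Step : ∀ {nV nE} → (Fin nE → Fin nV) → (Fin nE → Fin nV) →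
       Fin nE → Fin nV → Fin nV → Set
Step s t e u v = (s e ≡ u × t e ≡ v) ⊎ (t e ≡ u × s e ≡ v)

data Walk {nV nE : ℕ} (s t : Fin nE → Fin nV) :
          Fin nV → Fin nV → List (Fin nE) → Set where
  []   : ∀ {u} → Walk s t u u []
  step : ∀ {e u v w es} → Step s t e u v → Walk s t v w es → Walk s t u w (e ∷ es)

-- a forest: there is no nonempty closed trail (closed walk without
-- repeated edges), i.e. no cycle
IsForest : ∀ {nV nE} → (Fin nE → Fin nV) → (Fin nE → Fin nV) → Set
IsForest {nV} {nE} s t =
  ∀ (u : Fin nV) (es : List (Fin nE)) → Walk s t u u es → Unique es → es ≡ []

record Pair : Set where
  field
    nV nE    : ℕ
    src tgt  : Fin nE → Fin nV
    forest   : IsForest src tgt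
    len      : Fin nE → ℕ
    len-pos  : ∀ e → 1 ≤ len e
    inSV     : Fin nV → Bool
    inSE     : Fin nE → Bool
    subgraph : ∀ e → inSE e ≡ true → inSV (src e) ≡ true × inSV (tgt e) ≡ true
open Pair public

record Iso (P P' : Pair) : Set where
  field
    fV : Fin (nV P) → Fin (nV P')
    fE : Fin (nE P) → Fin (nE P')
    gV : Fin (nV P') → Fin (nV P)
    gE : Fin (nE P') → Fin (nE P)
    gfV : ∀ v → gV (fV v) ≡ v
    fgV : ∀ v → fV (gV v) ≡ v
    gfE : ∀ e → gE (fE e) ≡ e
    fgE : ∀ e → fE (gE e) ≡ e
    incid : ∀ e → (src P' (fE e) ≡ fV (src P e) × tgt P' (fE e) ≡ fV (tgt P e))
                ⊎ (src P' (fE e) ≡ fV (tgt P e) × tgt P' (fE e) ≡ fV (src P e))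
    isometric : ∀ e → len P' (fE e) ≡ len P e
    presSV : ∀ v → inSV P' (fV v) ≡ inSV P v
    presSE : ∀ e → inSE P' (fE e) ≡ inSE P e
open Iso public


-- The cells of the topological complement T ∖ S: vertices not in S and
-- (open) edges not in S.  Two cells are adjacent if one is a vertex and
-- the other an edge incident to it; components of T ∖ S (π₀(T∖S)) are the
-- classes of the equivalence relation generated by adjacency.

inS : (P : Pair) → Fin (nV P) ⊎ Fin (nE P) → Bool
inS P (inj₁ v) = inSV P v
inS P (inj₂ e) = inSE P e

Cell : Pair → Set
Cell P = Σ (Fin (nV P) ⊎ Fin (nE P)) (λ c → inS P c ≡ false)

Adj : (P : Pair) → Cell P → Cell P → Set
Adj P (inj₁ v , _) (inj₂ e , _) = (src P e ≡ v) ⊎ (tgt P e ≡ v)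
Adj P _ _ = ⊥

Conn : (P : Pair) → Cell P → Cell P → Set
Conn P = EqClosure (Adj P)

cellMap : ∀ {P P'} → Iso P P' → Cell P → Cell P'
cellMap F (inj₁ v , p) = inj₁ (fV F v) , trans (presSV F v) p
cellMap F (inj₂ e , p) = inj₂ (fE F e) , trans (presSE F e) p

-- functions π₀(T∖S) → {±1}: functions on cells, constant on components
record SignFn (P : Pair) : Set where
  field
    sgn  : Cell P → Sign
    resp : ∀ {x y} → Adj P x y → sgn x ≡ sgn y
open SignFn public

record SignedIso (P P' : Pair) : Set where
  constructor _⟨_⟩
  field
    iso : Iso P P'
    sgnF : SignFn P
open SignedIso public

-- The composite (ε₂F₂)∘(ε₁F₁) has underlying map F₂F₁ and sign
-- C ↦ ε₁(C)·ε₂(F₁C).  We spell out "(η G)∘(ε F) = (ε' F')∘(η G)":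
-- equality of underlying maps on vertices and edges and of sign functions.
SquareCommutes : ∀ {P P'} → SignedIso P P → SignedIso P P' → SignedIso P' P' → Set
SquareCommutes {P} (F ⟨ ε ⟩) (G ⟨ η ⟩) (F' ⟨ ε' ⟩) =
  (∀ v → fV G (fV F v) ≡ fV F' (fV G v)) ×
  (∀ e → fE G (fE F e) ≡ fE F' (fE G e)) ×
  (∀ (x : Cell P) → sgn ε x · sgn η (cellMap F x) ≡ sgn η x · sgn ε' (cellMap G x))

record BYForest : Set where
  field
    pair : Pair
    aut  : Iso pair pair
    eps  : SignFn pair
open BYForest public

iter : ∀ {A : Set} → ℕ → (A → A) → A → A
iter zero    f x = x
iter (suc n) f x = iter n f (f x)

prodSign : ∀ {A : Set} → (A → Sign) → (A → A) → A → ℕ → Sign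
prodSign ε f x zero    = Sg.+
prodSign ε f x (suc q) = ε x · prodSign ε f (f x) q

SignedIsoBY : BYForest → BYForest → Set
SignedIsoBY B B' =
  Σ (SignedIso (pair B) (pair B')) λ H →
    SquareCommutes (aut B ⟨ eps B ⟩) H (aut B' ⟨ eps B' ⟩)

mkBY : (P : Pair) → Iso P P → SignFn P → BYForest
mkBY P F ε = record { pair = P ; aut = F ; eps = ε }

SameOrbitProducts : (P : Pair) → Iso P P → SignFn P → SignFn P → Set
SameOrbitProducts P F ε ε' =
  ∀ (x : Cell P) (q : ℕ) → 1 ≤ q →
    Conn P (iter q (cellMap F) x) x →
    (∀ j → 1 ≤ j → j < q → ¬ Conn P (iter j (cellMap F) x) x) →
    prodSign (sgn ε) (cellMap F) x q ≡ prodSign (sgn ε') (cellMap F) x q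

AtMostOneMinusPerOrbit : BYForest → Set
AtMostOneMinusPerOrbit B =
  ∀ (x y : Cell (pair B)) (k : ℕ) →
    Conn (pair B) (iter k (cellMap (aut B)) x) y →
    sgn (eps B) x ≡ Sg.- → sgn (eps B) y ≡ Sg.- →
    Conn (pair B) x y

-- Put δ = ε·ε′. In each F-orbit of components of T ∖ S choose a base component C₀ and set
-- η(FᵏC₀) = δ(C₀)⋯δ(Fᵏ⁻¹C₀) for 0 ≤ k < q, where q is the length of the orbit. Then
-- η(FC) = η(C)δ(C), that is ε(C)η(FC) = η(C)ε′(C), holds at every component C that is not the
-- last one of its orbit, and at the last one it says precisely that δ has product +1 over the
-- orbit. Hence the identity map signed by η is a signed isomorphism. For an arbitrary ε, the η
-- built from δ = ε turns ε into C ↦ ε(C)η(C)η(FC), which is +1 except possibly at the last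
-- component of each orbit.
module Submission where

open import Level using (0ℓ)
open import Axiom.UniquenessOfIdentityProofs using (module Decidable⇒UIP)
open import Data.Bool using (Bool; true; false)
import Data.Bool as Bool
open import Data.Fin using (Fin; toℕ; splitAt; join)
import Data.Fin as Fin
open import Data.Fin.Properties using (any?; pigeonhole; splitAt-join)
open import Data.Fin.Subset using (Subset; _∈_; _⊆_; _∪_; ⁅_⁆; ∣_∣)
open import Data.Fin.Subset.Properties
  using (_∈?_; _⊂?_; p⊂q⇒∣p∣<∣q∣; ⊆-antisym; ∣p∣≤n; p⊆p∪q; x∈p∪q⁺; x∈p∪q⁻; x∈⁅x⁆; x∈⁅y⁆⇒x≡y)
open import Data.List using (List; []; _∷_; length; lookup; map; allFin)
open import Data.List.Membership.Propositional using () renaming (_∈_ to _∈ₗ_)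
open import Data.List.Membership.Propositional.Properties using (∈-map⁺; ∈-allFin)
open import Data.List.Relation.Unary.Any using (Any; here; there)
import Data.List.Relation.Unary.Any as Any
open import Data.List.Relation.Unary.Any.Properties using (lookup-index)
open import Data.List.Relation.Unary.First using (First; [_]; _∷_)
import Data.List.Relation.Unary.First as First
open import Data.Nat using (ℕ; zero; suc; _+_; _∸_; _≤_; _<_; z≤n; s≤s; z<s; s<s)
open import Data.Nat.Properties
  using (<-cmp; ≤-<-trans; <⇒≱; anyUpTo?; n<1+n; m+[n∸m]≡n; ∸-monoʳ-<; +-comm; m<n⇒m<1+n; m≤n⇒m<n∨m≡n)
open import Data.Product using (Σ; ∃; _×_; _,_; proj₁; proj₂)
open import Data.Sign using (Sign) renaming (_*_ to _·_)
import Data.Sign as Sign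
open import Data.Sign.Properties using (*-assoc; *-identityʳ; s*s≡+; *-commutativeSemigroup)
open import Algebra.Properties.CommutativeSemigroup *-commutativeSemigroup using (interchange; x∙yz≈y∙xz)
open import Data.Sum using (_⊎_; inj₁; inj₂)
open import Data.Vec using (tabulate)
open import Data.Vec.Properties using (lookup∘tabulate; lookup⇒[]=; []=⇒lookup)
open import Function using (_∘_)
open import Relation.Binary using (Rel; tri<; tri≈; tri>)
import Relation.Binary as B
open import Relation.Binary.Bundles using (Setoid)
open import Relation.Binary.Structures using (IsDecEquivalence)
open import Relation.Binary.Construct.Closure.Equivalence using (EqClosure)
import Relation.Binary.Construct.Closure.Equivalence as EC
open import Relation.Binary.Construct.Closure.ReflexiveTransitive as Star using (_◅_; _◅◅_)
open import Relation.Binary.Construct.Closure.Symmetric using (SymClosure; fwd; bwd)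
open import Relation.Binary.PropositionalEquality
  using (_≡_; refl; sym; trans; cong; cong₂; subst; subst₂; module ≡-Reasoning)
import Relation.Binary.PropositionalEquality as ≡
open import Relation.Nullary using (¬_; yes; no; contradiction)
open import Relation.Nullary.Decidable using (does; dec-true; map′; _×-dec_; _⊎-dec_)
open import Relation.Unary using (Pred; Decidable; ∁; _≐_)

open import Defs

open Decidable⇒UIP Bool._≟_ using (≡-irrelevant)

record IsLeast (P : Pred ℕ 0ℓ) (m : ℕ) : Set where
  field
    holds : P m
    below : ∀ {j} → j < m → ¬ P j
open IsLeast

IsLeast-unique : ∀ {P m n} → IsLeast P m → IsLeast P n → m ≡ n
IsLeast-unique {m = m} {n} lm ln with <-cmp m n
... | tri< m<n _ _ = contradiction (holds lm) (below ln m<n)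
... | tri≈ _ m≡n _ = m≡n
... | tri> _ _ n<m = contradiction (holds ln) (below lm n<m)

IsLeast-resp-≐ : ∀ {P Q m} → P ≐ Q → IsLeast P m → IsLeast Q m
IsLeast-resp-≐ (P⊆Q , Q⊆P) lm = record
  { holds = P⊆Q (holds lm) ; below = λ j<m → below lm j<m ∘ Q⊆P }

least : ∀ {P} → Decidable P → ∀ {n} → P n → ∃ (IsLeast P)
least P? {zero} p = 0 , record { holds = p ; below = λ () }
least P? {suc n} p with P? 0
... | yes p₀ = 0 , record { holds = p₀ ; below = λ () }
... | no ¬p₀ with m , lm ← least (P? ∘ suc) p = suc m , record
  { holds = holds lm ; below = λ { {zero} _ → ¬p₀ ; {suc j} (s<s j<m) → below lm j<m } }

module _ {A : Set} {P : Pred A 0ℓ} (P? : Decidable P) where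

  firstWitness : ∀ {xs} → Any P xs → First (∁ P) P xs
  firstWitness {x ∷ _} a with P? x
  ... | yes px = [ px ]
  ... | no ¬px = ¬px ∷ firstWitness (Any.tail ¬px a)

  choose : ∀ xs → Any P xs → A
  choose xs a = lookup xs (First.index (firstWitness a))

  choose-satisfies : ∀ xs (a : Any P xs) → P (choose xs a)
  choose-satisfies xs a = First.index-satisfied (firstWitness a)

module _ {A : Set} {P Q : Pred A 0ℓ} (P≐Q : P ≐ Q) where

  First-index-≐ : ∀ {xs} (w : First (∁ P) P xs) (v : First (∁ Q) Q xs) →
                  First.index w ≡ First.index v
  First-index-≐ [ _ ]     [ _ ]     = refl
  First-index-≐ [ px ]    (¬qx ∷ _) = contradiction (proj₁ P≐Q px) ¬qx
  First-index-≐ (¬px ∷ _) [ qx ]    = contradiction (proj₂ P≐Q qx) ¬px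
  First-index-≐ (_ ∷ w)   (_ ∷ v)   = cong Fin.suc (First-index-≐ w v)

  choose-cong : (P? : Decidable P) (Q? : Decidable Q) →
                ∀ xs (a : Any P xs) (b : Any Q xs) → choose P? xs a ≡ choose Q? xs b
  choose-cong P? Q? xs a b =
    cong (lookup xs) (First-index-≐ (firstWitness P? a) (firstWitness Q? b))

module Listing {A : Set} (xs : List A) (∈-xs : ∀ x → x ∈ₗ xs) where

  code : A → Fin (length xs)
  code x = Any.index (∈-xs x)

  decode : Fin (length xs) → A
  decode = lookup xs

  decode-code : ∀ x → decode (code x) ≡ x
  decode-code x = sym (lookup-index (∈-xs x))

  code-injective : ∀ {x y} → code x ≡ code y → x ≡ y
  code-injective {x} {y} e = trans (sym (decode-code x)) (trans (cong decode e) (decode-code y))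

module _ {A : Set} (f : A → A) where

  iter-suc : ∀ k x → iter (suc k) f x ≡ f (iter k f x)
  iter-suc zero    x = refl
  iter-suc (suc k) x = iter-suc k (f x)

  iter-+ : ∀ m n x → iter (m + n) f x ≡ iter n f (iter m f x)
  iter-+ zero    n x = refl
  iter-+ (suc m) n x = iter-+ m n (f x)

-- Connected components of a finite graph

module _ {n} {P : Pred (Fin n) 0ℓ} (P? : Decidable P) where

  toSubset : Subset n
  toSubset = tabulate (does ∘ P?)

  ∈-toSubset⁺ : ∀ {i} → P i → i ∈ toSubset
  ∈-toSubset⁺ {i} p = lookup⇒[]= i toSubset (trans (lookup∘tabulate _ i) (dec-true (P? i) p))

  ∈-toSubset⁻ : ∀ {i} → i ∈ toSubset → P i
  ∈-toSubset⁻ {i} i∈ with P? i | trans (sym (lookup∘tabulate (does ∘ P?) i)) ([]=⇒lookup i∈)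
  ... | yes p | _ = p
  ... | no  _ | ()

module _ {n} (g : Subset n → Subset n) (inflationary : ∀ s → s ⊆ g s) where

  iter-inflationary : ∀ k s → s ⊆ iter k g s
  iter-inflationary zero    s = λ x∈s → x∈s
  iter-inflationary (suc k) s = iter-inflationary k (g s) ∘ inflationary s

  fixed-or-grows : ∀ s → g s ≡ s ⊎ ∣ s ∣ < ∣ g s ∣
  fixed-or-grows s with s ⊂? g s
  ... | yes s⊂gs = inj₂ (p⊂q⇒∣p∣<∣q∣ s⊂gs)
  ... | no  s⊄gs = inj₁ (⊆-antisym gs⊆s (inflationary s))
    where
    gs⊆s : g s ⊆ s
    gs⊆s {x} x∈gs with x ∈? s
    ... | yes x∈s = x∈s
    ... | no  x∉s = contradiction ((λ {y} → inflationary s {y}) , x , x∈gs , x∉s) s⊄gs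

  iter-fixed-or-large : ∀ k s → g (iter k g s) ≡ iter k g s ⊎ k ≤ ∣ iter k g s ∣
  iter-fixed-or-large zero    s = inj₂ z≤n
  iter-fixed-or-large (suc k) s rewrite iter-suc g k s with iter-fixed-or-large k s
  ... | inj₁ fixed = inj₁ (cong g fixed)
  ... | inj₂ large with fixed-or-grows (iter k g s)
  ...   | inj₁ fixed = inj₁ (cong g fixed)
  ...   | inj₂ grows = inj₂ (≤-<-trans large grows)

  iter-fixedPoint : ∀ s → g (iter (suc n) g s) ≡ iter (suc n) g s
  iter-fixedPoint s with iter-fixed-or-large (suc n) s
  ... | inj₁ fixed = fixed
  ... | inj₂ large = contradiction (∣p∣≤n (iter (suc n) g s)) (<⇒≱ large)

symClosure? : ∀ {A : Set} {R : Rel A 0ℓ} → B.Decidable R → B.Decidable (SymClosure R)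
symClosure? R? a b = map′ (λ { (inj₁ r) → fwd r ; (inj₂ r) → bwd r })
                          (λ { (fwd r) → inj₁ r ; (bwd r) → inj₂ r })
                          (R? a b ⊎-dec R? b a)

module DecidableEqClosure {A : Set} {R : Rel A 0ℓ} (R? : B.Decidable R)
                          (xs : List A) (∈-xs : ∀ x → x ∈ₗ xs) where

  open Listing xs ∈-xs

  private
    N = length xs

    Linked : Fin N → Fin N → Set
    Linked i j = SymClosure R (decode i) (decode j)

    linkedFrom? : (s : Subset N) → Decidable (λ j → ∃ λ i → i ∈ s × Linked i j)
    linkedFrom? s j = any? (λ i → i ∈? s ×-dec symClosure? R? (decode i) (decode j))

    grow : Subset N → Subset N
    grow s = s ∪ toSubset (linkedFrom? s)

    grow-inflationary : ∀ s → s ⊆ grow s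
    grow-inflationary s = p⊆p∪q _

    component : A → Subset N
    component x = iter (suc N) grow ⁅ code x ⁆

    component-closed : ∀ {x i j} → i ∈ component x → Linked i j → j ∈ component x
    component-closed {x} i∈ l = subst (_ ∈_) (iter-fixedPoint grow grow-inflationary ⁅ code x ⁆)
                                      (x∈p∪q⁺ (inj₂ (∈-toSubset⁺ (linkedFrom? _) (_ , i∈ , l))))

    component-complete : ∀ {x a b} → EqClosure R a b → code a ∈ component x → code b ∈ component x
    component-complete Star.ε a∈ = a∈
    component-complete {a = a} (_◅_ {j = b} l p) a∈ = component-complete p
      (component-closed a∈ (subst₂ (SymClosure R) (sym (decode-code a)) (sym (decode-code b)) l))

    iter-grow-sound : ∀ {x} k s → (∀ {i} → i ∈ s → EqClosure R x (decode i)) →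
                      ∀ {j} → j ∈ iter k grow s → EqClosure R x (decode j)
    iter-grow-sound zero    s sound = sound
    iter-grow-sound (suc k) s sound = iter-grow-sound k (grow s) grow-sound
      where
      grow-sound : ∀ {i} → i ∈ grow s → EqClosure R _ (decode i)
      grow-sound i∈ with x∈p∪q⁻ s _ i∈
      ... | inj₁ i∈s = sound i∈s
      ... | inj₂ i∈new with h , h∈s , l ← ∈-toSubset⁻ (linkedFrom? s) i∈new = sound h∈s ◅◅ (l ◅ Star.ε)

    component-sound : ∀ {x j} → j ∈ component x → EqClosure R x (decode j)
    component-sound {x} = iter-grow-sound (suc N) ⁅ code x ⁆ seed
      where
      seed : ∀ {i} → i ∈ ⁅ code x ⁆ → EqClosure R x (decode i)
      seed i∈ rewrite x∈⁅y⁆⇒x≡y (code x) i∈ | decode-code x = Star.ε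

  eqClosure? : B.Decidable (EqClosure R)
  eqClosure? x y = map′
    (subst (EqClosure R x) (decode-code y) ∘ component-sound)
    (λ p → component-complete p (iter-inflationary grow grow-inflationary (suc N) _ (x∈⁅x⁆ (code x))))
    (code y ∈? component x)

·-cancel-middle : ∀ a b c → a · (b · (a · c)) ≡ b · c
·-cancel-middle a b c = begin
  a · (b · (a · c))   ≡⟨ x∙yz≈y∙xz a b (a · c) ⟩
  b · (a · (a · c))   ≡⟨ cong (b ·_) (sym (*-assoc a a c)) ⟩
  b · ((a · a) · c)   ≡⟨ cong (λ t → b · (t · c)) (s*s≡+ a) ⟩
  b · c               ∎
  where open ≡-Reasoning

module _ {A : Set} (f : A → A) where

  prodSign-snoc : ∀ (σ : A → Sign) x k → prodSign σ f x (suc k) ≡ prodSign σ f x k · σ (iter k f x)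
  prodSign-snoc σ x zero    = *-identityʳ (σ x)
  prodSign-snoc σ x (suc k) = trans (cong (σ x ·_) (prodSign-snoc σ (f x) k)) (sym (*-assoc (σ x) _ _))

  prodSign-· : ∀ (σ τ : A → Sign) x q →
               prodSign (λ y → σ y · τ y) f x q ≡ prodSign σ f x q · prodSign τ f x q
  prodSign-· σ τ x zero    = refl
  prodSign-· σ τ x (suc q) = trans (cong (σ x · τ x ·_) (prodSign-· σ τ (f x) q))
                                   (interchange (σ x) (τ x) _ _)

-- Orbits of an injective self-map of a finite setoid

module Orbits {A : Set} {_≈_ : Rel A 0ℓ} (isDecEquivalence : IsDecEquivalence _≈_)
              (xs : List A) (∈-xs : ∀ x → x ∈ₗ xs)
              (f : A → A) (f-cong : ∀ {x y} → x ≈ y → f x ≈ f y)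
              (f-injective : ∀ {x y} → f x ≈ f y → x ≈ y) where

  open IsDecEquivalence isDecEquivalence renaming (refl to ≈-refl; sym to ≈-sym; trans to ≈-trans)
  open Listing xs ∈-xs

  ≈-setoid : Setoid 0ℓ 0ℓ
  ≈-setoid = record { isEquivalence = isEquivalence }

  open import Relation.Binary.Reasoning.Setoid ≈-setoid

  iter-cong : ∀ k {x y} → x ≈ y → iter k f x ≈ iter k f y
  iter-cong zero    x≈y = x≈y
  iter-cong (suc k) x≈y = iter-cong k (f-cong x≈y)

  iter-injective : ∀ k {x y} → iter k f x ≈ iter k f y → x ≈ y
  iter-injective zero    e = e
  iter-injective (suc k) e = f-injective (iter-injective k e)

  iter-suc-≈ : ∀ k x → iter (suc k) f x ≈ f (iter k f x)
  iter-suc-≈ k x = reflexive (iter-suc f k x)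

  returns : ∀ y → ∃ λ p → iter (suc p) f y ≈ y
  returns y with i , j , i<j , same ← pigeonhole (n<1+n (length xs)) (λ i → code (iter (toℕ i) f y)) =
    p , ≈-sym (iter-injective (toℕ i) (begin
      iter (toℕ i) f y                    ≈⟨ reflexive (code-injective same) ⟩
      iter (toℕ j) f y                    ≡⟨ cong (λ t → iter t f y) j≡1+p+i ⟩
      iter (suc p + toℕ i) f y            ≡⟨ iter-+ f (suc p) (toℕ i) y ⟩
      iter (toℕ i) f (iter (suc p) f y)   ∎))
    where
    p = toℕ j ∸ suc (toℕ i)
    j≡1+p+i : toℕ j ≡ suc p + toℕ i
    j≡1+p+i = trans (sym (m+[n∸m]≡n i<j)) (cong suc (+-comm (toℕ i) p))

  period : A → ℕ
  period y = proj₁ (returns y)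

  -- Bounded by the period so that it is decidable.
  Reach : A → A → Set
  Reach y x = ∃ λ k → k < suc (period y) × iter k f y ≈ x

  reach? : B.Decidable Reach
  reach? y x = anyUpTo? (λ k → iter k f y ≟ x) (suc (period y))

  Reach-refl : ∀ x → Reach x x
  Reach-refl x = 0 , z<s , ≈-refl

  Reach-resp : ∀ {y x x′} → x ≈ x′ → Reach y x → Reach y x′
  Reach-resp x≈x′ (k , k≤p , arrive) = k , k≤p , ≈-trans arrive x≈x′

  Reach-f : ∀ {y x} → Reach y x → Reach y (f x)
  Reach-f {y} {x} (k , s≤s k≤p , arrive) with m≤n⇒m<n∨m≡n k≤p
  ... | inj₁ k<p = suc k , s≤s k<p , ≈-trans (iter-suc-≈ k y) (f-cong arrive)
  ... | inj₂ refl = 0 , z<s , (begin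
    y                  ≈⟨ ≈-sym (proj₂ (returns y)) ⟩
    iter (suc k) f y   ≈⟨ iter-suc-≈ k y ⟩
    f (iter k f y)     ≈⟨ f-cong arrive ⟩
    f x                ∎)

  Reach-f⁻ : ∀ {y x} → Reach y (f x) → Reach y x
  Reach-f⁻ {y} (zero , _ , y≈fx) = period y , n<1+n _ ,
    f-injective (≈-trans (≈-sym (iter-suc-≈ (period y) y)) (≈-trans (proj₂ (returns y)) y≈fx))
  Reach-f⁻ {y} (suc k , s≤s k<p , arrive) = k , m<n⇒m<1+n k<p ,
    f-injective (≈-trans (≈-sym (iter-suc-≈ k y)) arrive)

  opaque
    rep : A → A
    rep x = choose (λ y → reach? y x) xs (Any.map (λ { refl → Reach-refl x }) (∈-xs x))

    rep-reaches : ∀ x → Reach (rep x) x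
    rep-reaches x = choose-satisfies (λ y → reach? y x) xs _

    rep-cong : ∀ {x x′} → x ≈ x′ → rep x ≡ rep x′
    rep-cong x≈x′ = choose-cong (Reach-resp x≈x′ , Reach-resp (≈-sym x≈x′)) _ _ xs _ _

    rep-f : ∀ x → rep (f x) ≡ rep x
    rep-f x = choose-cong (Reach-f⁻ , Reach-f) _ _ xs _ _

  rep-iter : ∀ k x → rep (iter k f x) ≡ rep x
  rep-iter zero    x = refl
  rep-iter (suc k) x = trans (rep-iter k (f x)) (rep-f x)

  leastArrival : ∀ x → ∃ (IsLeast (λ k → iter k f (rep x) ≈ x))
  leastArrival x with k , _ , arrive ← rep-reaches x = least (λ k → iter k f (rep x) ≟ x) {k} arrive

  depth : A → ℕ
  depth x = proj₁ (leastArrival x)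

  depth-isLeast : ∀ x → IsLeast (λ k → iter k f (rep x) ≈ x) (depth x)
  depth-isLeast x = proj₂ (leastArrival x)

  depth-unique : ∀ {x r d} → rep x ≡ r → IsLeast (λ k → iter k f r ≈ x) d → depth x ≡ d
  depth-unique refl = IsLeast-unique (depth-isLeast _)

  depth-cong : ∀ {x x′} → x ≈ x′ → depth x ≡ depth x′
  depth-cong {x} {x′} x≈x′ = depth-unique (rep-cong x≈x′)
    (IsLeast-resp-≐ ((λ a → ≈-trans a (≈-sym x≈x′)) , (λ a → ≈-trans a x≈x′)) (depth-isLeast x′))

  depth-f : ∀ {x} → ¬ f x ≈ rep x → depth (f x) ≡ suc (depth x)
  depth-f {x} fx≉r = depth-unique (rep-f x) record
    { holds = ≈-trans (iter-suc-≈ (depth x) (rep x)) (f-cong (holds L))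
    ; below = λ { {zero} _ r≈fx → fx≉r (≈-sym r≈fx)
                ; {suc j} (s≤s j<d) arrive →
                    below L j<d (f-injective (≈-trans (≈-sym (iter-suc-≈ j (rep x))) arrive)) } }
    where L = depth-isLeast x

  depth-f-return : ∀ {x} → f x ≈ rep x → depth (f x) ≡ 0
  depth-f-return {x} fx≈r = depth-unique (rep-f x) record { holds = ≈-sym fx≈r ; below = λ () }

  ReturnsAt : A → ℕ → Set
  ReturnsAt y j = 1 ≤ j × iter j f y ≈ y

  orbitLength : ∀ {x} → f x ≈ rep x → IsLeast (ReturnsAt (rep x)) (suc (depth x))
  orbitLength {x} fx≈r = record
    { holds = s≤s z≤n , ≈-trans (iter-suc-≈ d r) (≈-trans (f-cong (holds L)) fx≈r)
    ; below = λ { (s≤s j≤d) (1≤j , ret) → below L (∸-monoʳ-< 1≤j j≤d) (arrives j≤d ret) } }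
    where
    r = rep x
    d = depth x
    L = depth-isLeast x
    arrives : ∀ {j} → j ≤ d → iter j f r ≈ r → iter (d ∸ j) f r ≈ x
    arrives {j} j≤d ret = begin
      iter (d ∸ j) f r               ≈⟨ iter-cong (d ∸ j) (≈-sym ret) ⟩
      iter (d ∸ j) f (iter j f r)    ≡⟨ iter-+ f j (d ∸ j) r ⟨
      iter (j + (d ∸ j)) f r         ≡⟨ cong (λ t → iter t f r) (m+[n∸m]≡n j≤d) ⟩
      iter d f r                     ≈⟨ holds L ⟩
      x                              ∎

  module _ (δ : A → Sign) (δ-cong : ∀ {x y} → x ≈ y → δ x ≡ δ y) where

    prefixProduct : A → Sign
    prefixProduct x = prodSign δ f (rep x) (depth x)

    prefixProduct-cong : ∀ {x x′} → x ≈ x′ → prefixProduct x ≡ prefixProduct x′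
    prefixProduct-cong x≈x′ = cong₂ (prodSign δ f) (rep-cong x≈x′) (depth-cong x≈x′)

    prodSign-suc-depth : ∀ x → prodSign δ f (rep x) (suc (depth x)) ≡ prefixProduct x · δ x
    prodSign-suc-depth x = trans (prodSign-snoc f δ (rep x) (depth x))
                                 (cong (prefixProduct x ·_) (δ-cong (holds (depth-isLeast x))))

    prefixProduct-f : ∀ {x} → ¬ f x ≈ rep x → prefixProduct (f x) ≡ prefixProduct x · δ x
    prefixProduct-f {x} fx≉r =
      trans (cong₂ (prodSign δ f) (rep-f x) (depth-f fx≉r)) (prodSign-suc-depth x)

    prefixProduct-cocycle : (∀ y q → IsLeast (ReturnsAt y) q → prodSign δ f y q ≡ Sign.+) →
                            ∀ x → prefixProduct (f x) ≡ prefixProduct x · δ x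
    prefixProduct-cocycle trivial x with f x ≟ rep x
    ... | no  fx≉r = prefixProduct-f fx≉r
    ... | yes fx≈r = trans (cong (prodSign δ f _) (depth-f-return fx≈r))
                           (trans (sym (trivial _ _ (orbitLength fx≈r))) (prodSign-suc-depth x))

    normalised : A → Sign
    normalised x = δ x · (prefixProduct x · prefixProduct (f x))

    normalised-cong : ∀ {x x′} → x ≈ x′ → normalised x ≡ normalised x′
    normalised-cong x≈x′ = cong₂ _·_ (δ-cong x≈x′)
      (cong₂ _·_ (prefixProduct-cong x≈x′) (prefixProduct-cong (f-cong x≈x′)))

    normalised-minus⇒return : ∀ {x} → normalised x ≡ Sign.- → f x ≈ rep x
    normalised-minus⇒return {x} minus with f x ≟ rep x
    ... | yes fx≈r = fx≈r
    ... | no  fx≉r = contradiction (trans (sym minus) plus) λ ()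
      where
      plus : normalised x ≡ Sign.+
      plus = trans (cong (λ s → δ x · (prefixProduct x · s)) (prefixProduct-f fx≉r))
                   (trans (cong (δ x ·_) (·-cancel-middle (prefixProduct x) Sign.+ (δ x))) (s*s≡+ (δ x)))

    normalised-minus-unique : ∀ {x y} k → iter k f x ≈ y →
                              normalised x ≡ Sign.- → normalised y ≡ Sign.- → x ≈ y
    normalised-minus-unique {x} {y} k same minusˣ minusʸ = f-injective (begin
      f x               ≈⟨ normalised-minus⇒return minusˣ ⟩
      rep x             ≡⟨ rep-iter k x ⟨
      rep (iter k f x)  ≡⟨ rep-cong same ⟩
      rep y             ≈⟨ ≈-sym (normalised-minus⇒return minusʸ) ⟩
      f y               ∎)

module _ {X : Set} (b : X → Bool) where

  consIfFalse : ∀ c v → b c ≡ v → List (Σ X λ c → b c ≡ false) → List (Σ X λ c → b c ≡ false)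
  consIfFalse c true  _  rest = rest
  consIfFalse c false eq rest = (c , eq) ∷ rest

  falsesIn : List X → List (Σ X λ c → b c ≡ false)
  falsesIn []       = []
  falsesIn (c ∷ cs) = consIfFalse c (b c) refl (falsesIn cs)

  ∈-falsesIn : ∀ {c cs} (p : b c ≡ false) → c ∈ₗ cs → (c , p) ∈ₗ falsesIn cs
  ∈-falsesIn {c} {_ ∷ cs} p (here refl) = here-case (b c) refl
    where
    here-case : ∀ v (eq : b c ≡ v) → (c , p) ∈ₗ consIfFalse c v eq (falsesIn cs)
    here-case true  eq = contradiction (trans (sym eq) p) λ ()
    here-case false eq = here (cong (c ,_) (≡-irrelevant p eq))
  ∈-falsesIn {cs = c′ ∷ cs} p (there c∈cs) = there-case (b c′) refl
    where
    there-case : ∀ v (eq : b c′ ≡ v) → (_ , p) ∈ₗ consIfFalse c′ v eq (falsesIn cs)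
    there-case true  _ = ∈-falsesIn p c∈cs
    there-case false _ = there (∈-falsesIn p c∈cs)

module _ (P : Pair) where

  allCellCodes : List (Fin (nV P) ⊎ Fin (nE P))
  allCellCodes = map (splitAt (nV P)) (allFin (nV P + nE P))

  ∈-allCellCodes : ∀ c → c ∈ₗ allCellCodes
  ∈-allCellCodes c = subst (_∈ₗ allCellCodes) (splitAt-join (nV P) (nE P) c)
                           (∈-map⁺ (splitAt (nV P)) (∈-allFin (join (nV P) (nE P) c)))

  allCells : List (Cell P)
  allCells = falsesIn (inS P) allCellCodes

  ∈-allCells : ∀ x → x ∈ₗ allCells
  ∈-allCells (c , p) = ∈-falsesIn (inS P) p (∈-allCellCodes c)

  adj? : B.Decidable (Adj P)
  adj? (inj₁ v , _) (inj₂ e , _) = (src P e Fin.≟ v) ⊎-dec (tgt P e Fin.≟ v)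
  adj? (inj₁ _ , _) (inj₁ _ , _) = no λ ()
  adj? (inj₂ _ , _) _            = no λ ()

  Conn-isDecEquivalence : IsDecEquivalence (Conn P)
  Conn-isDecEquivalence = record { isEquivalence = EC.isEquivalence (Adj P) ; _≟_ = eqClosure? }
    where open DecidableEqClosure adj? allCells ∈-allCells

  sgn-Conn : (σ : SignFn P) → ∀ {x y} → Conn P x y → sgn σ x ≡ sgn σ y
  sgn-Conn σ = EC.gfold ≡.isEquivalence (sgn σ) (resp σ)

  idIso : Iso P P
  idIso = record
    { fV = λ v → v ; fE = λ e → e ; gV = λ v → v ; gE = λ e → e
    ; gfV = λ _ → refl ; fgV = λ _ → refl ; gfE = λ _ → refl ; fgE = λ _ → refl
    ; incid = λ _ → inj₁ (refl , refl) ; isometric = λ _ → refl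
    ; presSV = λ _ → refl ; presSE = λ _ → refl }

  cellMap-id : ∀ x → cellMap idIso x ≡ x
  cellMap-id (inj₁ _ , _) = refl
  cellMap-id (inj₂ _ , _) = refl

cell-≡ : ∀ {P c c′} {p : inS P c ≡ false} {p′ : inS P c′ ≡ false} →
         c ≡ c′ → _≡_ {A = Cell P} (c , p) (c′ , p′)
cell-≡ {c = c} {p = p} {p′} refl = cong (c ,_) (≡-irrelevant p p′)

module _ {P P′ : Pair} (F : Iso P P′) where

  fV-transpose : ∀ {a b} → b ≡ fV F a → a ≡ gV F b
  fV-transpose {a} b≡Fa = trans (sym (gfV F a)) (cong (gV F) (sym b≡Fa))

  Iso-inverse : Iso P′ P
  Iso-inverse = record
    { fV = gV F ; fE = gE F ; gV = fV F ; gE = fE F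
    ; gfV = fgV F ; fgV = gfV F ; gfE = fgE F ; fgE = gfE F
    ; incid = incid⁻
    ; isometric = λ e → trans (sym (isometric F (gE F e))) (cong (len P′) (fgE F e))
    ; presSV = λ v → trans (sym (presSV F (gV F v))) (cong (inSV P′) (fgV F v))
    ; presSE = λ e → trans (sym (presSE F (gE F e))) (cong (inSE P′) (fgE F e)) }
    where
    incid⁻ : ∀ e → (src P (gE F e) ≡ gV F (src P′ e) × tgt P (gE F e) ≡ gV F (tgt P′ e))
                 ⊎ (src P (gE F e) ≡ gV F (tgt P′ e) × tgt P (gE F e) ≡ gV F (src P′ e))
    incid⁻ e with fE F (gE F e) | fgE F e | incid F (gE F e)
    ... | _ | refl | inj₁ (s , t) = inj₁ (fV-transpose s , fV-transpose t)
    ... | _ | refl | inj₂ (s , t) = inj₂ (fV-transpose t , fV-transpose s)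

  cellMap-inverse : ∀ x → cellMap Iso-inverse (cellMap F x) ≡ x
  cellMap-inverse (inj₁ v , _) = cell-≡ (cong inj₁ (gfV F v))
  cellMap-inverse (inj₂ e , _) = cell-≡ (cong inj₂ (gfE F e))

  cellMap-Adj : ∀ {x y} → Adj P x y → Adj P′ (cellMap F x) (cellMap F y)
  cellMap-Adj {inj₁ v , _} {inj₂ e , _} v∈e with incid F e | v∈e
  ... | inj₁ (s , _) | inj₁ refl = inj₁ s
  ... | inj₁ (_ , t) | inj₂ refl = inj₂ t
  ... | inj₂ (_ , t) | inj₁ refl = inj₂ t
  ... | inj₂ (s , _) | inj₂ refl = inj₁ s

cellMap-Conn : ∀ {P P′} (F : Iso P P′) {x y} → Conn P x y → Conn P′ (cellMap F x) (cellMap F y)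
cellMap-Conn F = EC.gmap (cellMap F) (cellMap-Adj F)

cellMap-Conn⁻ : ∀ {P P′} (F : Iso P P′) {x y} → Conn P′ (cellMap F x) (cellMap F y) → Conn P x y
cellMap-Conn⁻ {P} F {x} {y} c =
  subst₂ (Conn P) (cellMap-inverse F x) (cellMap-inverse F y) (cellMap-Conn (Iso-inverse F) c)

module ComponentOrbits (P : Pair) (F : Iso P P) =
  Orbits (Conn-isDecEquivalence P) (allCells P) (∈-allCells P) (cellMap F) (cellMap-Conn F) (cellMap-Conn⁻ F)

idSignedIsoBY : ∀ (B : BYForest) (ε′ η : SignFn (pair B)) →
                (∀ x → sgn (eps B) x · sgn η (cellMap (aut B) x) ≡ sgn η x · sgn ε′ x) →
                SignedIsoBY B (mkBY (pair B) (aut B) ε′)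
idSignedIsoBY B ε′ η square =
  idIso (pair B) ⟨ η ⟩ , (λ _ → refl) , (λ _ → refl) ,
  λ x → trans (square x) (cong (λ y → sgn η x · sgn ε′ y) (sym (cellMap-id (pair B) x)))

sameOrbitProducts⇒signedIsoBY : ∀ (P : Pair) (F : Iso P P) (ε ε′ : SignFn P) →
  SameOrbitProducts P F ε ε′ → SignedIsoBY (mkBY P F ε) (mkBY P F ε′)
sameOrbitProducts⇒signedIsoBY P F ε ε′ same = idSignedIsoBY (mkBY P F ε) ε′ η square
  where
  open ComponentOrbits P F
  δ : Cell P → Sign
  δ x = sgn ε x · sgn ε′ x
  δ-cong : ∀ {x y} → Conn P x y → δ x ≡ δ y
  δ-cong c = cong₂ _·_ (sgn-Conn P ε c) (sgn-Conn P ε′ c)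
  trivial : ∀ y q → IsLeast (ReturnsAt y) q → prodSign δ (cellMap F) y q ≡ Sign.+
  trivial y q L = trans (prodSign-· (cellMap F) (sgn ε) (sgn ε′) y q)
    (trans (cong (_· prodSign (sgn ε′) (cellMap F) y q)
                 (same y q (proj₁ (holds L)) (proj₂ (holds L)) (λ j 1≤j j<q r → below L j<q (1≤j , r))))
           (s*s≡+ (prodSign (sgn ε′) (cellMap F) y q)))
  η : SignFn P
  η = record { sgn = prefixProduct δ δ-cong ; resp = λ adj → prefixProduct-cong δ δ-cong (EC.return adj) }
  square : ∀ x → sgn ε x · sgn η (cellMap F x) ≡ sgn η x · sgn ε′ x
  square x = trans (cong (sgn ε x ·_) (prefixProduct-cocycle δ δ-cong trivial x))
                   (·-cancel-middle (sgn ε x) (sgn η x) (sgn ε′ x))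

signedIsoBY-normalForm : ∀ (B : BYForest) →
  Σ BYForest λ B′ → SignedIsoBY B B′ × AtMostOneMinusPerOrbit B′
signedIsoBY-normalForm B =
  mkBY P F ε′ , idSignedIsoBY B ε′ η square ,
  λ x y k → normalised-minus-unique δ δ-cong {x} {y} k
  where
  P : Pair
  P = pair B
  F : Iso P P
  F = aut B
  open ComponentOrbits P F
  δ : Cell P → Sign
  δ = sgn (eps B)
  δ-cong : ∀ {x y} → Conn P x y → δ x ≡ δ y
  δ-cong = sgn-Conn P (eps B)
  η : SignFn P
  η = record { sgn = prefixProduct δ δ-cong ; resp = λ adj → prefixProduct-cong δ δ-cong (EC.return adj) }
  ε′ : SignFn P
  ε′ = record { sgn = normalised δ δ-cong ; resp = λ adj → normalised-cong δ δ-cong (EC.return adj) }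
  square : ∀ x → δ x · sgn η (cellMap F x) ≡ sgn η x · sgn ε′ x
  square x = sym (·-cancel-middle (sgn η x) (δ x) (sgn η (cellMap F x)))

proposition2p7 :
    (∀ (P : Pair) (F : Iso P P) (ε ε' : SignFn P) →
       SameOrbitProducts P F ε ε' →
       SignedIsoBY (mkBY P F ε) (mkBY P F ε'))
    ×
    (∀ (B : BYForest) →
       Σ BYForest λ B' → SignedIsoBY B B' × AtMostOneMinusPerOrbit B')
proposition2p7 = sameOrbitProducts⇒signedIsoBY , signedIsoBY-normalForm
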